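{- An oriented graph derived from a Burling tree has no directed cycles, and its underlying graph has no triangles.
   Context: A Burling tree is a 4-tuple $(T,r,\lambda,c)$: $T$ a rooted tree with root $r$; $\lambda$ assigns to each non-leaf $v$ one of its children, its last-born; for $v\neq r$ not a last-born, $c(v)$ is the vertex set of a (possibly empty) branch (downward path $v_1\dots v_k$, each $v_i$ the parent of $v_{i+1}$) starting at the last-born of the parent of $v$, and $c(v)=\varnothing$ if $v$ is a last-born or the root. The oriented graph fully derived from it has vertex set $V(T)$ and arc $uv$ iff $v\in c(u)$; an oriented graph derived from it is any induced subgraph of this oriented graph. -}

module Defs where

open import Data.Nat using (ℕ; zero; suc; _≥_)
open import Data.Fin using (Fin)
open import Data.Fin.Subset using (Subset) renaming (_∈_ to _∈ₛ_)
open import Data.Maybe using (Maybe; just; nothing)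
open import Data.List using (List; []; _∷_; length; head; last)
open import Data.List.Membership.Propositional using (_∈_)
open import Data.List.Relation.Unary.Unique.Propositional using (Unique)
open import Data.List.Relation.Unary.All using (All)
open import Data.Product using (Σ; ∃; _×_; _,_)
open import Data.Sum using (_⊎_)
open import Function using (_∘_)
open import Relation.Nullary using (¬_)
open import Relation.Binary.PropositionalEquality using (_≡_; _≢_)

iterM : {A : Set} → (A → Maybe A) → ℕ → A → Maybe A
iterM f zero    a = just a
iterM f (suc k) a with f a
... | just b  = iterM f k b
... | nothing = nothing

-- A rooted tree on vertex set Fin n, given by its root and parent map:
-- the root is the unique vertex without a parent, and every vertex reaches
-- the root by following parents (hence the underlying graph is a tree).
record RootedTree (n : ℕ) : Set where
  field
    root      : Fin n
    parent    : Fin n → Maybe (Fin n)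
    root-only : ∀ v → parent v ≡ nothing → v ≡ root
    root-top  : parent root ≡ nothing
    reaches   : ∀ v → ∃ λ k → iterM parent k v ≡ just root

  Child : Fin n → Fin n → Set
  Child u v = parent u ≡ just v

  Leaf : Fin n → Set
  Leaf v = ∀ u → ¬ Child u v

  data Branch : List (Fin n) → Set where
    []  : Branch []
    [_] : ∀ x → Branch (x ∷ [])
    _∷_ : ∀ {x y xs} → Child y x → Branch (y ∷ xs) → Branch (x ∷ y ∷ xs)

-- A Burling tree (T, r, λ, c).  λ v = just w means w is the last-born of v;
-- c v is the branch (as a list of its vertices, listed top-down).
record BurlingTree (n : ℕ) : Set where
  field
    tree : RootedTree n
  open RootedTree tree public
  field
    lastBorn        : Fin n → Maybe (Fin n)
    lastBorn-child  : ∀ v w → lastBorn v ≡ just w → Child w v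
    lastBorn-nonleaf : ∀ v → lastBorn v ≡ nothing → Leaf v
    c               : Fin n → List (Fin n)

  IsLastBorn : Fin n → Set
  IsLastBorn v = ∃ λ p → parent v ≡ just p × lastBorn p ≡ just v

  field
    c-branch   : ∀ v → Branch (c v)
    c-start    : ∀ v p → parent v ≡ just p → ¬ IsLastBorn v →
                 c v ≡ [] ⊎ ∃ λ w → lastBorn p ≡ just w × head (c v) ≡ just w
    c-lastBorn : ∀ v → IsLastBorn v → c v ≡ []
    c-root     : c root ≡ []

  Arc : Fin n → Fin n → Set
  Arc u v = v ∈ c u

  Adj : Fin n → Fin n → Set
  Adj u v = Arc u v ⊎ Arc v u

module _ {n : ℕ} (B : BurlingTree n) (S : Subset n) where
  open BurlingTree B

  data Consecutive : List (Fin n) → Set where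
    []  : Consecutive []
    [_] : ∀ x → Consecutive (x ∷ [])
    _∷_ : ∀ {x y xs} → Arc x y → Consecutive (y ∷ xs) → Consecutive (x ∷ y ∷ xs)

  last' : Fin n → List (Fin n) → Fin n
  last' x []       = x
  last' x (y ∷ ys) = last' y ys

  record DirectedCycle : Set where
    field
      first    : Fin n
      rest     : List (Fin n)
      inS      : All (_∈ₛ S) (first ∷ rest)
      distinct : Unique (first ∷ rest)
      path     : Consecutive (first ∷ rest)
      closing  : Arc (last' first rest) first

  Triangle : Set
  Triangle = Σ (Fin n) λ a → Σ (Fin n) λ b → Σ (Fin n) λ d →
    a ∈ₛ S × b ∈ₛ S × d ∈ₛ S × a ≢ b × b ≢ d × a ≢ d ×
    Adj a b × Adj b d × Adj a d

{-# OPTIONS --safe #-}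
-- Measure every vertex by its depth.  An arc u → v has v below the last-born
-- w of u's parent, and w is as deep as u; v is strictly deeper than u unless
-- v = w, and a last-born has no out-arcs.  So depth strictly increases along
-- any path of two arcs, which rules out directed cycles.  In a transitive
-- triangle x → y, x → z, y → z, the vertices y and z lie on the branch c x,
-- so one descends from the other.  If z descends from y, then y and the
-- last-born above z given by y → z are ancestors of z of equal depth, so y is
-- a last-born; if y descends from z, the depth bound for y → z forces y = z,
-- a loop.
module Submission where

open import Defs
open import Data.Nat using (ℕ; zero; suc; _+_; _≤_; _<_)
open import Data.Nat.Properties
  using (+-cancelʳ-≡; m≤n+m; ≤∧≢⇒<; ≤-refl; ≤-trans; ≤-antisym; <-trans; <-irrefl; <⇒≱)
open import Data.Fin using (Fin)
open import Data.Fin.Subset using (Subset)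
open import Data.Maybe using (Maybe; just; nothing)
open import Data.Maybe.Properties using (just-injective)
open import Data.List using ([]; _∷_; head)
open import Data.List.Membership.Propositional using (_∈_)
open import Data.List.Membership.Propositional.Properties.Core using (∉[])
open import Data.List.Relation.Unary.Any using (here; there)
open import Data.Empty using (⊥-elim)
open import Data.Sum using (_⊎_; inj₁; inj₂)
open import Data.Product using (_×_; _,_; ∃; proj₁; proj₂)
open import Relation.Nullary using (¬_)
open import Relation.Binary.PropositionalEquality

iterM-+ : ∀ {A : Set} (f : A → Maybe A) k j {a b} →
          iterM f k a ≡ just b → iterM f (k + j) a ≡ iterM f j b
iterM-+ f zero    j refl = refl
iterM-+ f (suc k) j {a} eq with f a
... | just a′ = iterM-+ f k j eq

module RootedTreeProperties {n : ℕ} (T : RootedTree n) where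
  open RootedTree T

  Descendant : Fin n → Fin n → Set
  Descendant v w = ∃ λ j → iterM parent j v ≡ just w

  iterM-parent-root : ∀ j → iterM parent (suc j) root ≡ nothing
  iterM-parent-root j rewrite root-top = refl

  distance-to-root-unique : ∀ k m {v} →
    iterM parent k v ≡ just root → iterM parent m v ≡ just root → k ≡ m
  distance-to-root-unique zero    zero    _    _  = refl
  distance-to-root-unique zero    (suc m) refl e    with () ← trans (sym (iterM-parent-root m)) e
  distance-to-root-unique (suc k) zero    e    refl with () ← trans (sym (iterM-parent-root k)) e
  distance-to-root-unique (suc k) (suc m) {v} e₁ e₂ with parent v
  ... | just p = cong suc (distance-to-root-unique k m e₁ e₂)

  depth : Fin n → ℕ
  depth v = proj₁ (reaches v)

  depth-descendant : ∀ j {v w} → iterM parent j v ≡ just w → depth v ≡ j + depth w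
  depth-descendant j {v} {w} e = distance-to-root-unique (depth v) (j + depth w)
    (proj₂ (reaches v)) (trans (iterM-+ parent j (depth w) e) (proj₂ (reaches w)))

  depth-mono : ∀ {v w} → Descendant v w → depth w ≤ depth v
  depth-mono {v} {w} (j , e) rewrite depth-descendant j e = m≤n+m (depth w) j

  iterM-parent-child : ∀ {v w} → Child v w → iterM parent 1 v ≡ just w
  iterM-parent-child ch rewrite ch = refl

  depth-child : ∀ {v w} → Child v w → depth v ≡ suc (depth w)
  depth-child ch = depth-descendant 1 (iterM-parent-child ch)

  depth-siblings : ∀ {u v p} → Child u p → Child v p → depth u ≡ depth v
  depth-siblings cu cv = trans (depth-child cu) (sym (depth-child cv))

  ancestor-unique : ∀ {v x y} → Descendant v x → Descendant v y → depth x ≡ depth y → x ≡ y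
  ancestor-unique {v} {x} {y} (j , ex) (k , ey) dx≡dy = just-injective (begin
    just x               ≡⟨ sym ex ⟩
    iterM parent j v     ≡⟨ cong (λ i → iterM parent i v) j≡k ⟩
    iterM parent k v     ≡⟨ ey ⟩
    just y               ∎)
    where
    open ≡-Reasoning
    j≡k : j ≡ k
    j≡k = +-cancelʳ-≡ (depth y) j k (begin
      j + depth y  ≡⟨ cong (j +_) (sym dx≡dy) ⟩
      j + depth x  ≡⟨ sym (depth-descendant j ex) ⟩
      depth v      ≡⟨ depth-descendant k ey ⟩
      k + depth y  ∎)

  branch-descendant : ∀ {l w v} → Branch l → head l ≡ just w → v ∈ l → Descendant v w
  branch-descendant [ _ ]     refl (here refl) = 0 , refl
  branch-descendant (_ ∷ _)   refl (here refl) = 0 , refl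
  branch-descendant (ch ∷ br) refl (there v∈) with branch-descendant br refl v∈
  ... | j , e = j + 1 , trans (iterM-+ parent j 1 e) (iterM-parent-child ch)

  branch-comparable : ∀ {l y z} → Branch l → y ∈ l → z ∈ l → Descendant z y ⊎ Descendant y z
  branch-comparable [ _ ]     (here refl) (here refl) = inj₁ (0 , refl)
  branch-comparable (ch ∷ br) (here refl) z∈          = inj₁ (branch-descendant (ch ∷ br) refl z∈)
  branch-comparable (ch ∷ br) (there y∈)  (here refl) = inj₂ (branch-descendant (ch ∷ br) refl (there y∈))
  branch-comparable (ch ∷ br) (there y∈)  (there z∈)  = branch-comparable br y∈ z∈

module BurlingTreeProperties {n : ℕ} (B : BurlingTree n) where
  open BurlingTree B
  open RootedTreeProperties tree

  no-arc-from-empty : ∀ {u v} → c u ≡ [] → ¬ Arc u v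
  no-arc-from-empty e a = ∉[] (subst (_ ∈_) e a)

  lastBorn-no-arc : ∀ {v t} → IsLastBorn v → ¬ Arc v t
  lastBorn-no-arc lb = no-arc-from-empty (c-lastBorn _ lb)

  arc-below-lastBorn : ∀ {u v} → Arc u v →
    ∃ λ w → IsLastBorn w × depth w ≡ depth u × Descendant v w
  arc-below-lastBorn {u} a with parent u in pu
  ... | nothing = ⊥-elim (no-arc-from-empty (subst (λ r → c r ≡ []) (sym (root-only u pu)) c-root) a)
  ... | just p with c-start u p pu (λ lb → lastBorn-no-arc lb a)
  ...   | inj₁ e = ⊥-elim (no-arc-from-empty e a)
  ...   | inj₂ (w , lbw , hd) =
    w , (p , w-child , lbw) , depth-siblings w-child pu , branch-descendant (c-branch u) hd a
    where
    w-child : Child w p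
    w-child = lastBorn-child p w lbw

  arc-depth-≤ : ∀ {u v} → Arc u v → depth u ≤ depth v
  arc-depth-≤ {v = v} a with arc-below-lastBorn a
  ... | _ , _ , dw≡du , v⊒w = subst (_≤ depth v) dw≡du (depth-mono v⊒w)

  arc-depth-< : ∀ {u v t} → Arc u v → Arc v t → depth u < depth v
  arc-depth-< a b with arc-below-lastBorn a
  ... | w , lbw , dw≡du , v⊒w = ≤∧≢⇒< (arc-depth-≤ a) λ du≡dv →
    lastBorn-no-arc (subst IsLastBorn (sym (ancestor-unique (0 , refl) v⊒w
      (trans (sym du≡dv) (sym dw≡du)))) lbw) b

  arc-irreflexive : ∀ {v} → ¬ Arc v v
  arc-irreflexive a = <-irrefl refl (arc-depth-< a a)

  no-directed-3-cycle : ∀ {x y z} → Arc x y → Arc y z → ¬ Arc z x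
  no-directed-3-cycle a b e = <-irrefl refl
    (<-trans (arc-depth-< a b) (<-trans (arc-depth-< b e) (arc-depth-< e a)))

  no-transitive-triangle : ∀ {x y z} → Arc x y → Arc x z → ¬ Arc y z
  no-transitive-triangle {y = y} {z} axy axz ayz with arc-below-lastBorn ayz | branch-comparable (c-branch _) axy axz
  ... | w , lbw , dw≡dy , z⊒w | inj₁ z⊒y =
    lastBorn-no-arc (subst IsLastBorn (sym (ancestor-unique z⊒y z⊒w (sym dw≡dy))) lbw) ayz
  ... | _ | inj₂ y⊒z =
    arc-irreflexive (subst (Arc y) (sym y≡z) ayz)
    where
    y≡z : y ≡ z
    y≡z = ancestor-unique (0 , refl) y⊒z (≤-antisym (arc-depth-≤ ayz) (depth-mono y⊒z))

  module _ (S : Subset n) where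

    consecutive-depth-≤ : ∀ {x xs} → Consecutive B S (x ∷ xs) → depth x ≤ depth (last' B S x xs)
    consecutive-depth-≤ [ _ ]   = ≤-refl
    consecutive-depth-≤ (a ∷ p) = ≤-trans (arc-depth-≤ a) (consecutive-depth-≤ p)

    no-directed-cycle : ¬ DirectedCycle B S
    no-directed-cycle record { rest = [] ; closing = cl } = arc-irreflexive cl
    no-directed-cycle record { rest = _ ∷ _ ; path = a ∷ p ; closing = cl } =
      <⇒≱ (arc-depth-< cl a) (consecutive-depth-≤ (a ∷ p))

    no-triangle : ¬ Triangle B S
    no-triangle (_ , _ , _ , _ , _ , _ , _ , _ , _ , inj₁ ab , inj₁ bd , inj₁ ad) = no-transitive-triangle ab ad bd
    no-triangle (_ , _ , _ , _ , _ , _ , _ , _ , _ , inj₁ ab , inj₁ bd , inj₂ da) = no-directed-3-cycle ab bd da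
    no-triangle (_ , _ , _ , _ , _ , _ , _ , _ , _ , inj₁ ab , inj₂ db , inj₁ ad) = no-transitive-triangle ad ab db
    no-triangle (_ , _ , _ , _ , _ , _ , _ , _ , _ , inj₁ ab , inj₂ db , inj₂ da) = no-transitive-triangle da db ab
    no-triangle (_ , _ , _ , _ , _ , _ , _ , _ , _ , inj₂ ba , inj₁ bd , inj₁ ad) = no-transitive-triangle ba bd ad
    no-triangle (_ , _ , _ , _ , _ , _ , _ , _ , _ , inj₂ ba , inj₁ bd , inj₂ da) = no-transitive-triangle bd ba da
    no-triangle (_ , _ , _ , _ , _ , _ , _ , _ , _ , inj₂ ba , inj₂ db , inj₁ ad) = no-directed-3-cycle ad db ba
    no-triangle (_ , _ , _ , _ , _ , _ , _ , _ , _ , inj₂ ba , inj₂ db , inj₂ da) = no-transitive-triangle db da ba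

lemma3p2 : ∀ {n : ℕ} (B : BurlingTree n) (S : Subset n) → ¬ DirectedCycle B S × ¬ Triangle B S
lemma3p2 B S = no-directed-cycle S , no-triangle S
  where open BurlingTreeProperties B
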